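{- Let $G$ be a finite simple graph of order $n_1$ having at least one connected component of order greater than two, and let $H$ be a connected finite simple graph of order $n_2$ having a vertex of degree $n_2-\gamma(H)$. Then $$\gamma_R(G\Box H)\le n_1(\gamma(H)+1)-\gamma(H)+1.$$
   Context: $\gamma(X)$ denotes the domination number of a graph $X$ (minimum size of a set $D$ such that every vertex outside $D$ has a neighbor in $D$). A Roman dominating function on $X$ is a map $f:V(X)\to\{0,1,2\}$ such that every vertex $v$ with $f(v)=0$ has a neighbor $u$ with $f(u)=2$; $\gamma_R(X)$ is the minimum of $\sum_v f(v)$ over such $f$. The Cartesian product $G\Box H$ has vertex set $V(G)\times V(H)$, with $(g,h)\sim(g',h')$ iff ($g=g'$ and $h\sim h'$) or ($g\sim g'$ and $h=h'$). -}

module Defs where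

open import Data.Nat using (ℕ; zero; suc; _+_; _*_; _≤_; _∸_)
open import Data.Bool using (Bool; true; false; _∧_; _∨_; if_then_else_)
open import Data.Fin using (Fin; quotient; remainder)
open import Data.Fin.Properties using (_≟_)
open import Data.Fin.Subset using (Subset; inside; outside; _∈_; ∣_∣)
open import Data.Vec using (lookup; tabulate)
open import Data.Vec.Functional using (Vector)
import Data.Vec.Functional as VF
open import Data.Product using (Σ; ∃; ∃-syntax; _×_; _,_)
open import Data.Sum using (_⊎_)
open import Data.List using (List; map; allFin; length; filterᵇ)
open import Data.Nat.ListAction using (sum)
open import Relation.Binary.PropositionalEquality using (_≡_; _≢_; refl; sym)
open import Data.Empty using (⊥-elim)
open import Data.Bool.Properties using (∧-zeroʳ)
open import Relation.Nullary using (¬_; does; yes; no)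

record Graph (n : ℕ) : Set where
  field
    adj     : Fin n → Fin n → Bool
    symm    : ∀ u v → adj u v ≡ adj v u
    irrefl  : ∀ v → adj v v ≡ false
open Graph public

Adj : ∀ {n} → Graph n → Fin n → Fin n → Set
Adj G u v = adj G u v ≡ true

degree : ∀ {n} → Graph n → Fin n → ℕ
degree {n} G v = length (filterᵇ (adj G v) (allFin n))

data Reachable {n} (G : Graph n) : Fin n → Fin n → Set where
  here : ∀ {v} → Reachable G v v
  step : ∀ {u v w} → Adj G u v → Reachable G v w → Reachable G u w

Connected : ∀ {n} → Graph n → Set
Connected G = ∀ u v → Reachable G u v

ComponentOrderGt2 : ∀ {n} → Graph n → Fin n → Set
ComponentOrderGt2 G v =
  ∃[ a ] ∃[ b ] ∃[ c ] (a ≢ b × a ≢ c × b ≢ c ×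
    Reachable G v a × Reachable G v b × Reachable G v c)

HasComponentOfOrderGt2 : ∀ {n} → Graph n → Set
HasComponentOfOrderGt2 G = ∃[ v ] ComponentOrderGt2 G v

Dominating : ∀ {n} → Graph n → Subset n → Set
Dominating G D = ∀ v → v ∈ D ⊎ ∃[ u ] (u ∈ D × Adj G u v)

IsDominationNumber : ∀ {n} → Graph n → ℕ → Set
IsDominationNumber G k =
  (∃[ D ] (Dominating G D × ∣ D ∣ ≡ k)) ×
  (∀ D → Dominating G D → k ≤ ∣ D ∣)

RomanDominating : ∀ {n} → Graph n → (Fin n → Fin 3) → Set
RomanDominating G f =
  ∀ v → f v ≡ Fin.zero → ∃[ u ] (Adj G u v × f u ≡ Fin.suc (Fin.suc Fin.zero))
  where import Data.Fin as Fin

weight : ∀ {n} → (Fin n → Fin 3) → ℕ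
weight {n} f = sum (map (λ v → Data.Fin.toℕ (f v)) (allFin n))

IsRomanDominationNumber : ∀ {n} → Graph n → ℕ → Set
IsRomanDominationNumber G k =
  (∃[ f ] (RomanDominating G f × weight f ≡ k)) ×
  (∀ f → RomanDominating G f → k ≤ weight f)

adj-sym : ∀ {n} (G : Graph n) u v → adj G u v ≡ adj G v u
adj-sym G = symm G

dec-sym : ∀ {n} (x y : Fin n) → does (x ≟ y) ≡ does (y ≟ x)
dec-sym x y with x ≟ y | y ≟ x
... | yes _ | yes _ = refl
... | no _  | no _  = refl
... | yes p | no q  = ⊥-elim (q (sym p))
... | no p  | yes q = ⊥-elim (p (sym q))

-- Cartesian product G □ H on Fin (n₁ * n₂); vertex i corresponds to the
-- pair (quotient n₂ i , remainder n₂ i) (the inverse of Fin.combine).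
_□_ : ∀ {n₁ n₂} → Graph n₁ → Graph n₂ → Graph (n₁ * n₂)
_□_ {n₁} {n₂} G H = record
  { adj    = a
  ; symm   = sy
  ; irrefl = ir
  }
  where
  g : Fin (n₁ * n₂) → Fin n₁
  g = quotient n₂
  h : Fin (n₁ * n₂) → Fin n₂
  h = remainder {n₁} n₂
  a : Fin (n₁ * n₂) → Fin (n₁ * n₂) → Bool
  a x y = (does (g x ≟ g y) ∧ adj H (h x) (h y))
        ∨ (adj G (g x) (g y) ∧ does (h x ≟ h y))
  sy : ∀ x y → a x y ≡ a y x
  sy x y rewrite adj-sym G (g x) (g y) | adj-sym H (h x) (h y)
                | dec-sym (g x) (g y) | dec-sym (h x) (h y) = refl
  ir : ∀ x → a x x ≡ false
  ir x rewrite irrefl G (g x) | irrefl H (h x) | ∧-zeroʳ (does (g x ≟ g x)) = refl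

-- Take a vertex v of H of degree n₂ − γ(H) and a vertex c of G with two distinct
-- neighbours (it exists because some component of G has at least three vertices).
-- On G □ H put 2 on the layer G × {v}, 0 on the layers G × {h} with h ~ v, and on
-- each of the remaining n₂ − 1 − deg v = γ(H) − 1 layers a copy of the Roman
-- dominating function of G that is 2 at c, 0 on the neighbours of c and 1 elsewhere.
-- That copy weighs n₁ + 1 − deg c ≤ n₁ − 1, so the whole function weighs at most
-- 2 n₁ + (γ(H) − 1)(n₁ − 1) = n₁ (γ(H) + 1) − γ(H) + 1.
module Submission where

open import Defs
open import Data.Nat using (ℕ; _+_; _*_; _∸_; _≤_)
open import Data.Fin using (Fin)
open import Data.Product using (∃-syntax; _×_)
open import Relation.Binary.PropositionalEquality using (_≡_)

open import Data.Nat using (zero; suc; _<_; s≤s; z≤n)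
open import Data.Nat.Properties
  using ( +-*-semiring; ≤-refl; +-assoc; +-mono-≤; +-monoˡ-≤; +-monoʳ-≤; *-mono-≤
        ; +-cancelʳ-≤; +-suc; +-identityʳ; *-identityʳ; *-zeroʳ; m≤n+m∸n
        ; module ≤-Reasoning)
open import Data.Nat.ListAction using (sum)
open import Data.Nat.Tactic.RingSolver using (solve-∀)
open import Algebra.Properties.Semiring.Sum +-*-semiring
  using (sum-syntax; sum-cong-≗; ∑-distrib-+; *-distribˡ-sum; *-distribʳ-sum)
  renaming (sum to ∑)
open import Data.Fin using (zero; suc; toℕ; combine; quotient; remainder; _↑ˡ_; _↑ʳ_)
open import Data.Fin.Patterns using (0F; 1F; 2F)
open import Data.Fin.Properties using (_≟_; any?; remQuot-combine; combine-remQuot)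
open import Data.Bool using (Bool; true; false; not; _∨_; if_then_else_)
open import Data.Bool.Properties using (∨-zeroʳ) renaming (_≟_ to _≟ᵇ_)
open import Data.List using (List; []; _∷_; map; allFin; tabulate; length; filterᵇ)
open import Data.List.Properties using (map-tabulate)
open import Data.Product using (_,_; proj₁; proj₂)
open import Data.Sum using (_⊎_; inj₁; inj₂)
open import Data.Empty using (⊥-elim)
open import Function using (_∘_)
open import Relation.Nullary using (¬_; yes; no; does; ¬?; _×-dec_)
open import Relation.Nullary.Decidable using (dec-true)
open import Relation.Unary using (Decidable)
open import Relation.Binary.PropositionalEquality
  using (_≢_; refl; sym; trans; cong; cong₂; subst; module ≡-Reasoning)

𝟙 : Bool → ℕ
𝟙 b = if b then 1 else 0

δ : ∀ {n} → Fin n → Fin n → ℕ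
δ x i = 𝟙 (does (i ≟ x))

∑-const : ∀ n c → ∑[ i < n ] c ≡ n * c
∑-const zero    c = refl
∑-const (suc n) c = cong (c +_) (∑-const n c)

∑-mono-≤ : ∀ {n} {f g : Fin n → ℕ} → (∀ i → f i ≤ g i) → ∑ f ≤ ∑ g
∑-mono-≤ {zero}  f≤g = z≤n
∑-mono-≤ {suc n} f≤g = +-mono-≤ (f≤g zero) (∑-mono-≤ (f≤g ∘ suc))

∑-δ : ∀ {n} (x : Fin n) → ∑ (δ x) ≡ 1
∑-δ {suc n} zero    = cong suc (trans (∑-const n 0) (*-zeroʳ n))
∑-δ {suc n} (suc x) = ∑-δ x

∑-↑ : ∀ m {n} (f : Fin (m + n) → ℕ) →
      ∑ f ≡ ∑[ i < m ] f (i ↑ˡ n) + ∑[ j < n ] f (m ↑ʳ j)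
∑-↑ zero    f = refl
∑-↑ (suc m) f = trans (cong (f zero +_) (∑-↑ m (f ∘ suc))) (sym (+-assoc (f zero) _ _))

∑-combine : ∀ m {n} (f : Fin (m * n) → ℕ) →
            ∑ f ≡ ∑[ i < m ] ∑[ j < n ] f (combine i j)
∑-combine zero        f = refl
∑-combine (suc m) {n} f =
  trans (∑-↑ n f) (cong (∑[ j < n ] f (j ↑ˡ (m * n)) +_) (∑-combine m (f ∘ (n ↑ʳ_))))

sum-tabulate : ∀ {n} (f : Fin n → ℕ) → sum (tabulate f) ≡ ∑ f
sum-tabulate {zero}  f = refl
sum-tabulate {suc n} f = cong (f zero +_) (sum-tabulate (f ∘ suc))

sum-map-allFin : ∀ {n} (f : Fin n → ℕ) → sum (map f (allFin n)) ≡ ∑ f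
sum-map-allFin f = trans (cong sum (map-tabulate (λ i → i) f)) (sum-tabulate f)

length-filterᵇ : ∀ {a} {A : Set a} (p : A → Bool) (xs : List A) →
                 length (filterᵇ p xs) ≡ sum (map (𝟙 ∘ p) xs)
length-filterᵇ p []       = refl
length-filterᵇ p (x ∷ xs) with p x
... | true  = cong suc (length-filterᵇ p xs)
... | false = length-filterᵇ p xs

weight-∑ : ∀ {n} (f : Fin n → Fin 3) → weight f ≡ ∑[ x < n ] toℕ (f x)
weight-∑ f = sum-map-allFin (toℕ ∘ f)

module _ {n} (G : Graph n) where

  Adj-sym : ∀ {u v} → Adj G u v → Adj G v u
  Adj-sym {u} {v} u~v = trans (symm G v u) u~v

  degree-∑ : ∀ v → degree G v ≡ ∑[ u < n ] 𝟙 (adj G v u)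
  degree-∑ v = trans (length-filterᵇ (adj G v) (allFin n)) (sum-map-allFin (𝟙 ∘ adj G v))

  remote : Fin n → Fin n → Bool
  remote v u = not (does (u ≟ v) ∨ adj G v u)

  #remote : Fin n → ℕ
  #remote v = ∑[ u < n ] 𝟙 (remote v u)

  #remote-degree : ∀ v → 1 + #remote v + degree G v ≡ n
  #remote-degree v = begin
    1 + #remote v + degree G v
      ≡⟨ cong₂ _+_ (cong (_+ #remote v) (∑-δ v)) (sym (degree-∑ v)) ⟨
    ∑ (δ v) + #remote v + ∑[ u < n ] 𝟙 (adj G v u)
      ≡⟨ trans (∑-distrib-+ (λ u → δ v u + 𝟙 (remote v u)) (𝟙 ∘ adj G v))
               (cong (_+ ∑ (𝟙 ∘ adj G v)) (∑-distrib-+ (δ v) (𝟙 ∘ remote v))) ⟨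
    ∑[ u < n ] (δ v u + 𝟙 (remote v u) + 𝟙 (adj G v u))
      ≡⟨ sum-cong-≗ pointwise ⟩
    ∑[ u < n ] 1
      ≡⟨ trans (∑-const n 1) (*-identityʳ n) ⟩
    n ∎
    where
    open ≡-Reasoning
    pointwise : ∀ u → 𝟙 (does (u ≟ v)) + 𝟙 (remote v u) + 𝟙 (adj G v u) ≡ 1
    pointwise u with u ≟ v
    ... | yes refl rewrite irrefl G u = refl
    ... | no _ with adj G v u
    ...   | true  = refl
    ...   | false = refl

  #remote<γ : ∀ {γ v} → degree G v ≡ n ∸ γ → #remote v < γ
  #remote<γ {γ} {v} deg-v = +-cancelʳ-≤ (degree G v) (suc (#remote v)) γ (begin
    1 + #remote v + degree G v  ≡⟨ #remote-degree v ⟩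
    n                           ≤⟨ m≤n+m∸n n γ ⟩
    γ + (n ∸ γ)                 ≡⟨ cong (γ +_) deg-v ⟨
    γ + degree G v              ∎)
    where open ≤-Reasoning

  HasTwoNeighbours : Fin n → Set
  HasTwoNeighbours c = ∃[ a ] ∃[ b ] (a ≢ b × Adj G c a × Adj G c b)

  hasTwoNeighbours? : Decidable HasTwoNeighbours
  hasTwoNeighbours? c = any? λ a → any? λ b →
    ¬? (a ≟ b) ×-dec (adj G c a ≟ᵇ true) ×-dec (adj G c b ≟ᵇ true)

  two-neighbours⇒2≤degree : ∀ {c} → HasTwoNeighbours c → 2 ≤ degree G c
  two-neighbours⇒2≤degree {c} (a , b , a≢b , c~a , c~b) = begin
    2                           ≡⟨ cong₂ _+_ (∑-δ a) (∑-δ b) ⟨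
    ∑ (δ a) + ∑ (δ b)           ≡⟨ ∑-distrib-+ (δ a) (δ b) ⟨
    ∑[ u < n ] (δ a u + δ b u)  ≤⟨ ∑-mono-≤ pointwise ⟩
    ∑[ u < n ] 𝟙 (adj G c u)    ≡⟨ degree-∑ c ⟨
    degree G c                  ∎
    where
    open ≤-Reasoning
    pointwise : ∀ u → 𝟙 (does (u ≟ a)) + 𝟙 (does (u ≟ b)) ≤ 𝟙 (adj G c u)
    pointwise u with u ≟ a | u ≟ b
    ... | yes refl | yes refl = ⊥-elim (a≢b refl)
    ... | yes refl | no _     rewrite c~a = ≤-refl
    ... | no _     | yes refl rewrite c~b = ≤-refl
    ... | no _     | no _     = z≤n

  module _ (unique : ∀ c a b → Adj G c a → Adj G c b → a ≡ b) where

    reachable⇒≡⊎Adj : ∀ {u x} → Reachable G u x → x ≡ u ⊎ Adj G u x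
    reachable⇒≡⊎Adj here = inj₁ refl
    reachable⇒≡⊎Adj (step {u} {y} {x} u~y y⇝x) with reachable⇒≡⊎Adj y⇝x
    ... | inj₁ refl = inj₂ u~y
    ... | inj₂ y~x  = inj₁ (unique y x u y~x (Adj-sym u~y))

    ¬ComponentOrderGt2 : ∀ v → ¬ ComponentOrderGt2 G v
    ¬ComponentOrderGt2 v (a , b , c , a≢b , a≢c , b≢c , v⇝a , v⇝b , v⇝c)
      with reachable⇒≡⊎Adj v⇝a | reachable⇒≡⊎Adj v⇝b | reachable⇒≡⊎Adj v⇝c
    ... | inj₁ refl | inj₁ refl | _         = a≢b refl
    ... | inj₁ refl | inj₂ _    | inj₁ refl = a≢c refl
    ... | inj₁ refl | inj₂ v~b  | inj₂ v~c  = b≢c (unique v b c v~b v~c)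
    ... | inj₂ _    | inj₁ refl | inj₁ refl = b≢c refl
    ... | inj₂ v~a  | inj₁ refl | inj₂ v~c  = a≢c (unique v a c v~a v~c)
    ... | inj₂ v~a  | inj₂ v~b  | _         = a≢b (unique v a b v~a v~b)

  component-order>2⇒two-neighbours : HasComponentOfOrderGt2 G → ∃[ c ] HasTwoNeighbours c
  component-order>2⇒two-neighbours (v , big) with any? hasTwoNeighbours?
  ... | yes two = two
  ... | no ¬two = ⊥-elim (¬ComponentOrderGt2 unique v big)
    where
    unique : ∀ c a b → Adj G c a → Adj G c b → a ≡ b
    unique c a b c~a c~b with a ≟ b
    ... | yes a≡b = a≡b
    ... | no  a≢b = ⊥-elim (¬two (c , a , b , a≢b , c~a , c~b))

module _ {n} (G : Graph n) (c : Fin n) where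

  star : Fin n → Fin 3
  star x = if does (x ≟ c) then 2F else if adj G c x then 0F else 1F

  star-centre : star c ≡ 2F
  star-centre rewrite dec-true (c ≟ c) refl = refl

  star-roman : RomanDominating G star
  star-roman x star-x≡0 with does (x ≟ c) | adj G c x in c~x
  star-roman x ()       | true  | _
  star-roman x _        | false | true  = c , c~x , star-centre
  star-roman x ()       | false | false

  star-weight : weight star + degree G c ≡ n + 1
  star-weight = begin
    weight star + degree G c
      ≡⟨ cong₂ _+_ (weight-∑ star) (degree-∑ G c) ⟩
    ∑[ x < n ] toℕ (star x) + ∑[ x < n ] 𝟙 (adj G c x)
      ≡⟨ ∑-distrib-+ (toℕ ∘ star) (𝟙 ∘ adj G c) ⟨
    ∑[ x < n ] (toℕ (star x) + 𝟙 (adj G c x))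
      ≡⟨ sum-cong-≗ pointwise ⟩
    ∑[ x < n ] (1 + δ c x)
      ≡⟨ ∑-distrib-+ (λ _ → 1) (δ c) ⟩
    ∑[ x < n ] 1 + ∑ (δ c)
      ≡⟨ cong₂ _+_ (trans (∑-const n 1) (*-identityʳ n)) (∑-δ c) ⟩
    n + 1 ∎
    where
    open ≡-Reasoning
    pointwise : ∀ x → toℕ (star x) + 𝟙 (adj G c x) ≡ 1 + 𝟙 (does (x ≟ c))
    pointwise x with x ≟ c
    ... | yes refl rewrite irrefl G x = refl
    ... | no _ with adj G c x
    ...   | true  = refl
    ...   | false = refl

  star-weight<n : HasTwoNeighbours G c → weight star < n
  star-weight<n two = +-cancelʳ-≤ 1 (suc (weight star)) n (begin
    suc (weight star) + 1     ≡⟨ +-suc (weight star) 1 ⟨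
    weight star + 2           ≤⟨ +-monoʳ-≤ (weight star) (two-neighbours⇒2≤degree G two) ⟩
    weight star + degree G c  ≡⟨ star-weight ⟩
    n + 1                     ∎)
    where open ≤-Reasoning

module _ {n₁ n₂ : ℕ} where

  quotient-combine : ∀ (g : Fin n₁) (h : Fin n₂) → quotient n₂ (combine g h) ≡ g
  quotient-combine g h = cong proj₁ (remQuot-combine {n₁} {n₂} g h)

  remainder-combine : ∀ (g : Fin n₁) (h : Fin n₂) → remainder {n₁} n₂ (combine g h) ≡ h
  remainder-combine g h = cong proj₂ (remQuot-combine {n₁} {n₂} g h)

  ∀-combine : ∀ {p} (P : Fin (n₁ * n₂) → Set p) →
              (∀ (g : Fin n₁) (h : Fin n₂) → P (combine g h)) → ∀ x → P x
  ∀-combine P P-combine x =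
    subst P (combine-remQuot {n₁} n₂ x) (P-combine (quotient n₂ x) (remainder {n₁} n₂ x))

module _ {n₁ n₂} (G : Graph n₁) (H : Graph n₂) where

  □-adjʳ : ∀ (g : Fin n₁) {h h′ : Fin n₂} → Adj H h h′ → Adj (G □ H) (combine g h) (combine g h′)
  □-adjʳ g {h} {h′} h~h′
    rewrite quotient-combine g h | quotient-combine g h′
          | remainder-combine g h | remainder-combine g h′
          | h~h′ | dec-true (g ≟ g) refl = refl

  □-adjˡ : ∀ {g g′ : Fin n₁} (h : Fin n₂) → Adj G g g′ → Adj (G □ H) (combine g h) (combine g′ h)
  □-adjˡ {g} {g′} h g~g′
    rewrite quotient-combine g h | quotient-combine g′ h
          | remainder-combine g h | remainder-combine g′ h
          | g~g′ | dec-true (h ≟ h) refl = ∨-zeroʳ _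

  module _ (ψ : Fin n₁ → Fin 3) (v : Fin n₂) where

    layeredAt : Fin n₁ → Fin n₂ → Fin 3
    layeredAt g h = if does (h ≟ v) then 2F else if adj H v h then 0F else ψ g

    layered : Fin (n₁ * n₂) → Fin 3
    layered x = layeredAt (quotient n₂ x) (remainder {n₁} n₂ x)

    layered-combine : ∀ g h → layered (combine g h) ≡ layeredAt g h
    layered-combine g h = cong₂ layeredAt (quotient-combine g h) (remainder-combine g h)

    layeredAt-centre : ∀ g → layeredAt g v ≡ 2F
    layeredAt-centre g rewrite dec-true (v ≟ v) refl = refl

    layeredAt-remote : ∀ {g h} → does (h ≟ v) ≡ false → adj H v h ≡ false → layeredAt g h ≡ ψ g
    layeredAt-remote h≢v v≁h rewrite h≢v | v≁h = refl

    layered-roman : RomanDominating G ψ → RomanDominating (G □ H) layered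
    layered-roman ψ-roman = ∀-combine Defended λ g h f≡0 →
      dominated g h (trans (sym (layered-combine g h)) f≡0)
      where
      Defended : Fin (n₁ * n₂) → Set
      Defended x = layered x ≡ 0F → ∃[ u ] (Adj (G □ H) u x × layered u ≡ 2F)

      dominated : ∀ g h → layeredAt g h ≡ 0F →
                  ∃[ u ] (Adj (G □ H) u (combine g h) × layered u ≡ 2F)
      dominated g h f≡0 with does (h ≟ v) in h≢v | adj H v h in v~h | ψ g in ψg
      dominated g h ()  | true  | _     | _
      dominated g h _   | false | true  | _ =
        combine g v , □-adjʳ g v~h , trans (layered-combine g v) (layeredAt-centre g)
      dominated g h _   | false | false | 0F with ψ-roman g ψg
      ... | u , u~g , ψu≡2 =
        combine u h , □-adjˡ h u~g ,
        trans (layered-combine u h) (trans (layeredAt-remote h≢v v~h) ψu≡2)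
      dominated g h ()  | false | false | suc _

    layered-weight : weight layered ≡ n₁ * 2 + #remote H v * weight ψ
    layered-weight = begin
      weight layered
        ≡⟨ weight-∑ layered ⟩
      ∑[ x < n₁ * n₂ ] toℕ (layered x)
        ≡⟨ ∑-combine n₁ (toℕ ∘ layered) ⟩
      ∑[ g < n₁ ] ∑[ h < n₂ ] toℕ (layered (combine g h))
        ≡⟨ sum-cong-≗ (λ g → sum-cong-≗ (λ h → cong toℕ (layered-combine g h))) ⟩
      ∑[ g < n₁ ] ∑[ h < n₂ ] toℕ (layeredAt g h)
        ≡⟨ sum-cong-≗ (λ g → sum-cong-≗ (pointwise g)) ⟩
      ∑[ g < n₁ ] ∑[ h < n₂ ] (2 * δ v h + 𝟙 (remote H v h) * toℕ (ψ g))
        ≡⟨ sum-cong-≗ layer ⟩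
      ∑[ g < n₁ ] (2 + #remote H v * toℕ (ψ g))
        ≡⟨ ∑-distrib-+ (λ _ → 2) (λ g → #remote H v * toℕ (ψ g)) ⟩
      ∑[ g < n₁ ] 2 + ∑[ g < n₁ ] (#remote H v * toℕ (ψ g))
        ≡⟨ cong₂ _+_ (sym (∑-const n₁ 2))
                     (trans (cong (#remote H v *_) (weight-∑ ψ))
                            (*-distribˡ-sum (#remote H v) (toℕ ∘ ψ))) ⟨
      n₁ * 2 + #remote H v * weight ψ ∎
      where
      open ≡-Reasoning
      pointwise : ∀ g h → toℕ (layeredAt g h) ≡
                          2 * 𝟙 (does (h ≟ v)) + 𝟙 (remote H v h) * toℕ (ψ g)
      pointwise g h with does (h ≟ v) | adj H v h
      ... | true  | _     = refl
      ... | false | true  = refl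
      ... | false | false = sym (+-identityʳ _)

      layer : ∀ g → ∑[ h < n₂ ] (2 * δ v h + 𝟙 (remote H v h) * toℕ (ψ g))
                    ≡ 2 + #remote H v * toℕ (ψ g)
      layer g = begin
        ∑[ h < n₂ ] (2 * δ v h + 𝟙 (remote H v h) * toℕ (ψ g))
          ≡⟨ ∑-distrib-+ (λ h → 2 * δ v h) (λ h → 𝟙 (remote H v h) * toℕ (ψ g)) ⟩
        ∑[ h < n₂ ] (2 * δ v h) + ∑[ h < n₂ ] (𝟙 (remote H v h) * toℕ (ψ g))
          ≡⟨ cong₂ _+_ (*-distribˡ-sum 2 (δ v)) (*-distribʳ-sum (toℕ (ψ g)) (𝟙 ∘ remote H v)) ⟨
        2 * ∑ (δ v) + #remote H v * toℕ (ψ g)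
          ≡⟨ cong (λ k → 2 * k + #remote H v * toℕ (ψ g)) (∑-δ v) ⟩
        2 + #remote H v * toℕ (ψ g) ∎

n*2+k*w+γ≤n*[γ+1]+1 : ∀ {n γ k w} → k < γ → w < n → n * 2 + k * w + γ ≤ n * (γ + 1) + 1
n*2+k*w+γ≤n*[γ+1]+1 {suc n} {suc γ} {k} {w} (s≤s k≤γ) (s≤s w≤n) = begin
  suc n * 2 + k * w + suc γ  ≤⟨ +-monoˡ-≤ (suc γ) (+-monoʳ-≤ (suc n * 2) (*-mono-≤ k≤γ w≤n)) ⟩
  suc n * 2 + γ * n + suc γ  ≡⟨ identity n γ ⟩
  suc n * (suc γ + 1) + 1    ∎
  where
  open ≤-Reasoning
  identity : ∀ n γ → suc n * 2 + γ * n + suc γ ≡ suc n * (suc γ + 1) + 1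
  identity = solve-∀

proposition16 : ∀ {n₁ n₂} (G : Graph n₁) (H : Graph n₂) (γH : ℕ) →
    HasComponentOfOrderGt2 G →
    Connected H →
    IsDominationNumber H γH →
    (∃[ v ] degree H v ≡ n₂ ∸ γH) →
    ∀ (r : ℕ) → IsRomanDominationNumber (G □ H) r →
    r + γH ≤ n₁ * (γH + 1) + 1
proposition16 {n₁} G H γH big _ _ (v , deg-v) r (_ , minimal)
  with component-order>2⇒two-neighbours G big
... | c , two = begin
  r + γH                                   ≤⟨ +-monoˡ-≤ γH (minimal f f-roman) ⟩
  weight f + γH                            ≡⟨ cong (_+ γH) (layered-weight G H ψ v) ⟩
  n₁ * 2 + #remote H v * weight ψ + γH     ≤⟨ n*2+k*w+γ≤n*[γ+1]+1 (#remote<γ H deg-v)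
                                                                   (star-weight<n G c two) ⟩
  n₁ * (γH + 1) + 1                        ∎
  where
  open ≤-Reasoning
  ψ = star G c
  f = layered G H ψ v
  f-roman = layered-roman G H ψ v (star-roman G c)
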